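{- Let $(A,X,I)$ be a formal context and $R_s,R_t\subseteq A\times X$ be $I$-compatible. Then their $I$-product $R_{st}$ is $I$-compatible.
   Context: A formal context is $(A,X,I)$ with $I\subseteq A\times X$. For $S\subseteq A\times X$, $B\subseteq A$, $Y\subseteq X$: $S^\uparrow[B]=\{x\mid\forall a\in B,\ aSx\}$, $S^\downarrow[Y]=\{a\mid\forall x\in Y,\ aSx\}$, $S^\uparrow[a]=S^\uparrow[\{a\}]$, $S^\downarrow[x]=S^\downarrow[\{x\}]$, $B^\uparrow=I^\uparrow[B]$, $Y^\downarrow=I^\downarrow[Y]$, $x^{\downarrow\uparrow}=\{x\}^{\downarrow\uparrow}$. Galois-stable: $B=B^{\uparrow\downarrow}$, $Y=Y^{\downarrow\uparrow}$. $R$ is $I$-compatible if $R^\downarrow[x]$ and $R^\uparrow[a]$ are Galois-stable for all $x,a$. The $I$-product of $R_s,R_t\subseteq A\times X$ is the relation $R_{st}\subseteq A\times X$ with $aR_{st}x$ iff $a\in R_s^\downarrow[I^\uparrow[R_t^\downarrow[x^{\downarrow\uparrow}]]]$. -}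

module Defs where

open import Level using (Level; suc)
open import Data.Product using (_×_)
open import Relation.Unary using (Pred; _⊆_; _≐_; ｛_｝)

record Context (ℓ : Level) : Set (suc ℓ) where
  field
    A : Set ℓ
    X : Set ℓ
    I : A → X → Set ℓ

module _ {ℓ : Level} (𝔽 : Context ℓ) where
  open Context 𝔽

  _↑[_] : (A → X → Set ℓ) → Pred A ℓ → Pred X ℓ
  (S ↑[ B ]) x = ∀ a → B a → S a x

  _↓[_] : (A → X → Set ℓ) → Pred X ℓ → Pred A ℓ
  (S ↓[ Y ]) a = ∀ x → Y x → S a x

  _↑ : Pred A ℓ → Pred X ℓ
  B ↑ = I ↑[ B ]

  _↓ : Pred X ℓ → Pred A ℓ
  Y ↓ = I ↓[ Y ]

  StableA : Pred A ℓ → Set ℓ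
  StableA B = B ≐ ((B ↑) ↓)

  StableX : Pred X ℓ → Set ℓ
  StableX Y = Y ≐ ((Y ↓) ↑)

  Compatible : (A → X → Set ℓ) → Set ℓ
  Compatible R = (∀ x → StableA (R ↓[ ｛ x ｝ ])) × (∀ a → StableX (R ↑[ ｛ a ｝ ]))

  product : (A → X → Set ℓ) → (A → X → Set ℓ) → A → X → Set ℓ
  product Rs Rt a x = (Rs ↓[ I ↑[ Rt ↓[ (｛ x ｝ ↓) ↑ ] ] ]) a

module Submission where

-- For a relation R ⊆ A × X write  column R x = {a | a R x}  and
-- row R a = {x | a R x}.  Since every set is contained in its Galois closure,
-- R is I-compatible iff all its columns and rows are closed (B↑↓ ⊆ B, Y↓↑ ⊆ Y).
-- Closed sets are closed under intersections, so R↓[Y] (an intersection of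
-- columns) is closed when the columns of R are, and dually for R↑[B].
-- When the rows of R are closed, R↓[Y↓↑] = R↓[Y]; hence the I-product is
--   a R_st x  iff  (column R_t x)↑ ⊆ row R_s a  iff  (row R_s a)↓ ⊆ column R_t x,
-- using that, for closed C and Y, C↑ ⊆ Y iff Y↓ ⊆ C.  Thus every column of
-- R_st is of the form R_s↓[Y] and every row of R_st equals R_t↑[(row R_s a)↓],
-- so both are closed, which is the compatibility of R_st.

open import Defs hiding (_↑; _↓; _↑[_]; _↓[_])
open import Level using (Level)
open import Data.Product using (_,_; proj₁; proj₂)
open import Relation.Binary.PropositionalEquality using (refl)
open import Relation.Unary using (Pred; _⊆_; _≐_; ｛_｝)
open import Relation.Unary.Properties using (≐-sym)

module GaloisClosure {ℓ : Level} (𝔽 : Context ℓ) where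
  open Context 𝔽

  _↑ : Pred A ℓ → Pred X ℓ
  _↑ = Defs._↑ 𝔽

  _↓ : Pred X ℓ → Pred A ℓ
  _↓ = Defs._↓ 𝔽

  _↑[_] : (A → X → Set ℓ) → Pred A ℓ → Pred X ℓ
  _↑[_] = Defs._↑[_] 𝔽

  _↓[_] : (A → X → Set ℓ) → Pred X ℓ → Pred A ℓ
  _↓[_] = Defs._↓[_] 𝔽

  ↑-antitone : {B C : Pred A ℓ} → B ⊆ C → C ↑ ⊆ B ↑
  ↑-antitone B⊆C y∈C↑ a a∈B = y∈C↑ a (B⊆C a∈B)

  ↓-antitone : {Y Z : Pred X ℓ} → Y ⊆ Z → Z ↓ ⊆ Y ↓
  ↓-antitone Y⊆Z a∈Z↓ x x∈Y = a∈Z↓ x (Y⊆Z x∈Y)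

  ↑↓-extensive : (B : Pred A ℓ) → B ⊆ (B ↑) ↓
  ↑↓-extensive B a∈B y y∈B↑ = y∈B↑ _ a∈B

  ↓↑-extensive : (Y : Pred X ℓ) → Y ⊆ (Y ↓) ↑
  ↓↑-extensive Y x∈Y a a∈Y↓ = a∈Y↓ _ x∈Y

  -- Closedness: the half of Galois stability that carries content.
  ClosedA : Pred A ℓ → Set ℓ
  ClosedA B = (B ↑) ↓ ⊆ B

  ClosedX : Pred X ℓ → Set ℓ
  ClosedX Y = (Y ↓) ↑ ⊆ Y

  closedA⇒stableA : {B : Pred A ℓ} → ClosedA B → StableA 𝔽 B
  closedA⇒stableA {B} closed = ↑↓-extensive B , closed

  closedX⇒stableX : {Y : Pred X ℓ} → ClosedX Y → StableX 𝔽 Y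
  closedX⇒stableX {Y} closed = ↓↑-extensive Y , closed

  ↑↓-monotone : {B C : Pred A ℓ} → B ⊆ C → (B ↑) ↓ ⊆ (C ↑) ↓
  ↑↓-monotone B⊆C = ↓-antitone (↑-antitone B⊆C)

  ↓↑-monotone : {Y Z : Pred X ℓ} → Y ⊆ Z → (Y ↓) ↑ ⊆ (Z ↓) ↑
  ↓↑-monotone Y⊆Z = ↑-antitone (↓-antitone Y⊆Z)

  closedA-resp-≐ : {B C : Pred A ℓ} → B ≐ C → ClosedA B → ClosedA C
  closedA-resp-≐ (B⊆C , C⊆B) closed a∈C↑↓ =
    B⊆C (closed (↑↓-monotone C⊆B a∈C↑↓))

  closedX-resp-≐ : {Y Z : Pred X ℓ} → Y ≐ Z → ClosedX Y → ClosedX Z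
  closedX-resp-≐ (Y⊆Z , Z⊆Y) closed x∈Z↓↑ =
    Y⊆Z (closed (↓↑-monotone Z⊆Y x∈Z↓↑))

  transpose-↑ : {C : Pred A ℓ} {Y : Pred X ℓ} → ClosedA C → C ↑ ⊆ Y → Y ↓ ⊆ C
  transpose-↑ closedC C↑⊆Y a∈Y↓ = closedC (↓-antitone C↑⊆Y a∈Y↓)

  transpose-↓ : {C : Pred A ℓ} {Y : Pred X ℓ} → ClosedX Y → Y ↓ ⊆ C → C ↑ ⊆ Y
  transpose-↓ closedY Y↓⊆C x∈C↑ = closedY (↑-antitone Y↓⊆C x∈C↑)

  column : (A → X → Set ℓ) → X → Pred A ℓ
  column R x a = R a x

  row : (A → X → Set ℓ) → A → Pred X ℓ
  row R a = R a

  ColumnsClosed : (A → X → Set ℓ) → Set ℓ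
  ColumnsClosed R = ∀ x → ClosedA (column R x)

  RowsClosed : (A → X → Set ℓ) → Set ℓ
  RowsClosed R = ∀ a → ClosedX (row R a)

  column-singleton : (R : A → X → Set ℓ) (x : X) → R ↓[ ｛ x ｝ ] ≐ column R x
  column-singleton R x = (λ r → r x refl) , (λ { r _ refl → r })

  row-singleton : (R : A → X → Set ℓ) (a : A) → R ↑[ ｛ a ｝ ] ≐ row R a
  row-singleton R a = (λ r → r a refl) , (λ { r _ refl → r })

  compatible⇒columnsClosed : {R : A → X → Set ℓ} → Compatible 𝔽 R → ColumnsClosed R
  compatible⇒columnsClosed {R} (stableColumns , _) x =
    closedA-resp-≐ (column-singleton R x) (proj₂ (stableColumns x))

  compatible⇒rowsClosed : {R : A → X → Set ℓ} → Compatible 𝔽 R → RowsClosed R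
  compatible⇒rowsClosed {R} (_ , stableRows) a =
    closedX-resp-≐ (row-singleton R a) (proj₂ (stableRows a))

  closed⇒compatible : {R : A → X → Set ℓ} → ColumnsClosed R → RowsClosed R → Compatible 𝔽 R
  closed⇒compatible {R} columnsClosed rowsClosed =
    (λ x → closedA⇒stableA (closedA-resp-≐ (≐-sym (column-singleton R x)) (columnsClosed x))) ,
    (λ a → closedX⇒stableX (closedX-resp-≐ (≐-sym (row-singleton R a)) (rowsClosed a)))

  -- An intersection of closed columns is closed: R↓[Y] = ⋂_{x ∈ Y} column R x.
  ↓-closed : {R : A → X → Set ℓ} → ColumnsClosed R → (Y : Pred X ℓ) → ClosedA (R ↓[ Y ])
  ↓-closed columnsClosed Y a∈closure x x∈Y =
    columnsClosed x (↑↓-monotone (λ r → r x x∈Y) a∈closure)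

  ↑-closed : {R : A → X → Set ℓ} → RowsClosed R → (B : Pred A ℓ) → ClosedX (R ↑[ B ])
  ↑-closed rowsClosed B x∈closure a a∈B =
    rowsClosed a (↓↑-monotone (λ r → r a a∈B) x∈closure)

  -- With closed rows, R↓ cannot distinguish Y from its closure:
  -- a ∈ R↓[Y] says Y ⊆ row R a, and then also Y↓↑ ⊆ row R a.
  ↓-closure-invariant : {R : A → X → Set ℓ} → RowsClosed R → (Y : Pred X ℓ) →
                        R ↓[ Y ] ⊆ R ↓[ (Y ↓) ↑ ]
  ↓-closure-invariant rowsClosed Y {a} r x x∈closure =
    rowsClosed a (↓↑-monotone (λ {x} x∈Y → r x x∈Y) x∈closure)

  ↓-point-closure : {R : A → X → Set ℓ} → RowsClosed R → (x : X) →
                    R ↓[ (｛ x ｝ ↓) ↑ ] ≐ column R x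
  ↓-point-closure {R} rowsClosed x =
    (λ r → r x (↓↑-extensive ｛ x ｝ refl)) ,
    (λ r → ↓-closure-invariant rowsClosed ｛ x ｝ (proj₂ (column-singleton R x) r))

  module Product (Rs Rt : A → X → Set ℓ) where

    Rst : A → X → Set ℓ
    Rst = product 𝔽 Rs Rt

    -- Each column of R_st is, by definition, R_s↓[ (R_t↓[x↓↑])↑ ].
    product-columnsClosed : ColumnsClosed Rs → ColumnsClosed Rst
    product-columnsClosed columnsClosedₛ x = ↓-closed columnsClosedₛ _

    -- Each row of R_st is R_t↑[(row R_s a)↓]:
    -- a R_st x  iff  (column R_t x)↑ ⊆ row R_s a  iff  (row R_s a)↓ ⊆ column R_t x.
    product-row : RowsClosed Rs → ColumnsClosed Rt → RowsClosed Rt →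
                  (a : A) → row Rst a ≐ Rt ↑[ row Rs a ↓ ]
    product-row rowsClosedₛ columnsClosedₜ rowsClosedₜ a = to , from
      where
      module _ {x : X} where
        columnₜ≐ : Rt ↓[ (｛ x ｝ ↓) ↑ ] ≐ column Rt x
        columnₜ≐ = ↓-point-closure rowsClosedₜ x

        to : Rst a x → (Rt ↑[ row Rs a ↓ ]) x
        to r b b∈rowₛ↓ =
          transpose-↑ (columnsClosedₜ x) (λ y∈ → r _ (↑-antitone (proj₁ columnₜ≐) y∈))
                      b∈rowₛ↓

        from : (Rt ↑[ row Rs a ↓ ]) x → Rst a x
        from r y y∈ =
          transpose-↓ (rowsClosedₛ a) (λ b∈ → r _ b∈) (↑-antitone (proj₂ columnₜ≐) y∈)

    product-rowsClosed : RowsClosed Rs → ColumnsClosed Rt → RowsClosed Rt → RowsClosed Rst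
    product-rowsClosed rowsClosedₛ columnsClosedₜ rowsClosedₜ a =
      closedX-resp-≐ (≐-sym (product-row rowsClosedₛ columnsClosedₜ rowsClosedₜ a))
                     (↑-closed rowsClosedₜ (row Rs a ↓))

lemmaA7 : ∀ {ℓ : Level} (𝔽 : Context ℓ) (Rs Rt : Context.A 𝔽 → Context.X 𝔽 → Set ℓ) → Compatible 𝔽 Rs → Compatible 𝔽 Rt → Compatible 𝔽 (product 𝔽 Rs Rt)
lemmaA7 𝔽 Rs Rt compatibleₛ compatibleₜ =
  closed⇒compatible
    (product-columnsClosed (compatible⇒columnsClosed compatibleₛ))
    (product-rowsClosed (compatible⇒rowsClosed compatibleₛ)
                        (compatible⇒columnsClosed compatibleₜ)
                        (compatible⇒rowsClosed compatibleₜ))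
  where
  open GaloisClosure 𝔽
  open Product Rs Rt
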